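{- Let $\mathbb T=(H_1,v_1,\alpha_1,H_2,v_2,\alpha_2)$ and $\mathbb T'=(H_1',v_1',\alpha_1',H_2',v_2',\alpha_2')$ be compatible split-templates. Let $(G_1,\Sigma_1),(G_2,\Sigma_2)$ be split siblings arising from $\mathbb T$ and $(G_1',\Sigma_1'),(G_2',\Sigma_2')$ split siblings arising from $\mathbb T'$. Then $(G_i,\Sigma_i)$ and $(G_i',\Sigma_i')$ are equivalent for $i=1,2$.
   Context: Graphs are finite with possible loops and parallel edges; $\operatorname{loops}(H)$ is the set of loops; $\delta_H(U)$ is the set of edges with exactly one end in $U$ (a cut), $\delta_H(v)=\delta_H(\{v\})$. A cycle is an edge set inducing even degrees. Graphs are equivalent if related by Whitney-flips (equivalently, have the same cycles, equivalently the same cuts). For $\Sigma\subseteq E(G)$, $\operatorname{ecycle}(G,\Sigma)$ is the binary matroid whose cycles are the cycles $C$ of $G$ with $|C\cap\Sigma|$ even. Signed graphs $(G_1,\Sigma_1),(G_2,\Sigma_2)$ are equivalent if $G_1,G_2$ are equivalent and $\Sigma_1\triangle\Sigma_2$ is a cut of $G_1$. Splitting $v$ into $v^-,v^+$ according to $\alpha\subseteq\delta_H(v)\cup\operatorname{loops}(H)$: loops in $\alpha$ get ends $v^-,v^+$; edges of $\delta_H(v)\cap\alpha$ are moved from $v$ to $v^-$; edges of $\delta_H(v)-\alpha$ to $v^+$; other edges unchanged. A split-template is $(H_1,v_1,\alpha_1,H_2,v_2,\alpha_2)$ with $H_1,H_2$ equivalent graphs, $v_i\in V(H_i)$, $\alpha_i\subseteq\delta_{H_i}(v_i)\cup\operatorname{loops}(H_i)$,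 such that the graphs $G_i$ obtained from $H_i$ by splitting $v_i$ according to $\alpha_i$ are inequivalent and the resulting signed graphs below are inequivalent; signed graphs $(G_1,\Sigma_1),(G_2,\Sigma_2)$ with these $G_i$ and $\operatorname{ecycle}(G_1,\Sigma_1)=\operatorname{ecycle}(G_2,\Sigma_2)$ are the split siblings arising from the template. Two split-templates as in the claim are compatible if $H_i$ and $H_i'$ are equivalent for $i=1,2$ and $\alpha_i\triangle\alpha_i'$ is a cut of $H_1$ for $i=1,2$. -}

module Defs where

open import Data.Nat using (ℕ; zero; suc; _+_)
open import Data.Nat.Divisibility using (_∣_)
open import Data.Fin using (Fin; zero; suc; inject₁; fromℕ; _≟_)
open import Data.Bool using (Bool; true; false; if_then_else_; _xor_; _∧_; not)
open import Data.Product using (Σ; _×_; _,_; proj₁; proj₂)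
open import Data.Sum using (_⊎_)
open import Data.Empty using (⊥)
open import Relation.Nullary using (¬_)
open import Relation.Nullary.Decidable using (⌊_⌋)
open import Relation.Binary.PropositionalEquality using (_≡_)

-- A graph with vertex set Fin n and edge set Fin m (loops and parallel
-- edges allowed): each edge has an (unordered) pair of ends.
record Graph (m : ℕ) : Set where
  field
    nV   : ℕ
    ends : Fin m → Fin nV × Fin nV
open Graph public

Sub : ℕ → Set
Sub k = Fin k → Bool

_∈ₛ_ : ∀ {k} → Fin k → Sub k → Set
x ∈ₛ S = S x ≡ true

_△_ : ∀ {k} → Sub k → Sub k → Sub k
(S △ T) x = S x xor T x

_∩_ : ∀ {k} → Sub k → Sub k → Sub k
(S ∩ T) x = S x ∧ T x

count : ∀ {k} → Sub k → ℕ
count {zero}  S = 0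
count {suc k} S = (if S zero then 1 else 0) + count (λ x → S (suc x))

Even : ℕ → Set
Even n = 2 ∣ n

eqV : ∀ {n} → Fin n → Fin n → Bool
eqV a b = ⌊ a ≟ b ⌋

-- number of ends of edge e at vertex v (a loop at v contributes 2)
endsAt : ∀ {m} (H : Graph m) → Fin (nV H) → Fin m → ℕ
endsAt H v e = (if eqV (proj₁ (ends H e)) v then 1 else 0)
             + (if eqV (proj₂ (ends H e)) v then 1 else 0)

deg : ∀ {m} (H : Graph m) → Sub m → Fin (nV H) → ℕ
deg {zero}  H C v = 0
deg {suc m} H C v = (if C zero then endsAt H v zero else 0)
                  + deg {m} (record { nV = nV H ; ends = λ e → ends H (suc e) })
                            (λ e → C (suc e)) v

IsCycle : ∀ {m} (H : Graph m) → Sub m → Set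
IsCycle H C = ∀ v → Even (deg H C v)

isLoopB : ∀ {m} (H : Graph m) → Fin m → Bool
isLoopB H e = eqV (proj₁ (ends H e)) (proj₂ (ends H e))

IsLoop : ∀ {m} (H : Graph m) → Fin m → Set
IsLoop H e = isLoopB H e ≡ true

δ : ∀ {m} (H : Graph m) → Sub (nV H) → Sub m
δ H U e = U (proj₁ (ends H e)) xor U (proj₂ (ends H e))

δv : ∀ {m} (H : Graph m) → Fin (nV H) → Sub m
δv H v = δ H (eqV v)

IsCut : ∀ {m} (H : Graph m) → Sub m → Set
IsCut H D = Σ (Sub (nV H)) λ U → ∀ e → D e ≡ δ H U e

_≈G_ : ∀ {m} → Graph m → Graph m → Set
H₁ ≈G H₂ = ∀ C → (IsCycle H₁ C → IsCycle H₂ C) × (IsCycle H₂ C → IsCycle H₁ C)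

SignedEquiv : ∀ {m} → Graph m → Sub m → Graph m → Sub m → Set
SignedEquiv G₁ Σ₁ G₂ Σ₂ = G₁ ≈G G₂ × IsCut G₁ (Σ₁ △ Σ₂)

IsECycle : ∀ {m} (G : Graph m) → Sub m → Sub m → Set
IsECycle G Σ' C = IsCycle G C × Even (count (C ∩ Σ'))

-- ecycle(G₁,Σ₁) = ecycle(G₂,Σ₂)  (binary matroids with the same cycles)
SameECycle : ∀ {m} → Graph m → Sub m → Graph m → Sub m → Set
SameECycle G₁ Σ₁ G₂ Σ₂ =
  ∀ C → (IsECycle G₁ Σ₁ C → IsECycle G₂ Σ₂ C) × (IsECycle G₂ Σ₂ C → IsECycle G₁ Σ₁ C)

-- Splitting v into v⁻ = inject₁ v and v⁺ = fromℕ (nV H) (the new vertex)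
-- according to α.
moveEnd : ∀ {n} → Fin n → Bool → Fin n → Fin (suc n)
moveEnd {n} v inα x = if eqV x v
                        then (if inα then inject₁ v else fromℕ n)
                        else inject₁ x

split : ∀ {m} (H : Graph m) → Fin (nV H) → Sub m → Graph m
split {m} H v α = record { nV = suc (nV H) ; ends = newEnds }
  where
  newEnds : Fin m → Fin (suc (nV H)) × Fin (suc (nV H))
  newEnds e with isLoopB H e | α e
  ... | true  | true  = inject₁ v , fromℕ (nV H)
  ... | true  | false = inject₁ (proj₁ (ends H e)) , inject₁ (proj₂ (ends H e))
  ... | false | a     = moveEnd v a (proj₁ (ends H e)) , moveEnd v a (proj₂ (ends H e))

Admissible : ∀ {m} (H : Graph m) → Fin (nV H) → Sub m → Set
Admissible H v α = ∀ e → e ∈ₛ α → (e ∈ₛ δv H v) ⊎ IsLoop H e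

record SplitTemplate (m : ℕ) : Set where
  field
    H₁ : Graph m
    v₁ : Fin (nV H₁)
    α₁ : Sub m
    H₂ : Graph m
    v₂ : Fin (nV H₂)
    α₂ : Sub m
    equivH  : H₁ ≈G H₂
    adm₁    : Admissible H₁ v₁ α₁
    adm₂    : Admissible H₂ v₂ α₂
    inequivG : ¬ (split H₁ v₁ α₁ ≈G split H₂ v₂ α₂)
  G₁ : Graph m
  G₁ = split H₁ v₁ α₁
  G₂ : Graph m
  G₂ = split H₂ v₂ α₂
open SplitTemplate public

SplitSiblings : ∀ {m} (T : SplitTemplate m) → Sub m → Sub m → Set
SplitSiblings T Σ₁ Σ₂ =
  SameECycle (G₁ T) Σ₁ (G₂ T) Σ₂ × ¬ SignedEquiv (G₁ T) Σ₁ (G₂ T) Σ₂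

Compatible : ∀ {m} → SplitTemplate m → SplitTemplate m → Set
Compatible T T' =
  (H₁ T ≈G H₁ T') × (H₂ T ≈G H₂ T')
  × IsCut (H₁ T) (α₁ T △ α₁ T') × IsCut (H₁ T) (α₂ T △ α₂ T')

-- All graphs involved have the cycle space Z of H₁: equivalent graphs share it, and splitting v
-- according to α keeps exactly the cycles in Z orthogonal to α (over GF(2)). Cuts are orthogonal
-- to cycles, so compatible templates cut out the same hyperplanes of Z, and G_i, G_i' have the same
-- cycles. The even cycles of the siblings give Z ∩ α₁⊥ ∩ Σ₁⊥ = Z ∩ α₂⊥ ∩ Σ₂⊥; as α₁ and α₂ differ
-- on Z, this forces Σ₁ to agree with α₂ on the cycles of G₁ (over GF(2) a functional is determined
-- by its kernel). The same holds for Σ₁', so Σ₁ △ Σ₁' is orthogonal to all cycles of G₁. By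
-- Gaussian elimination, the vectors orthogonal to the cycle space (the common kernel of the vertex
-- stars δ(v)) are the linear combinations of the stars, i.e. the cuts.

module Submission where

open import Defs
open import Algebra.Bundles using (CommutativeRing; CommutativeMonoid)
open import Data.Bool using (Bool; true; false; not; _xor_; _∧_; if_then_else_)
import Data.Bool.Properties as Bool
open import Data.Bool.Properties
  using (xor-∧-commutativeRing; ∧-commutativeMonoid; not-involutive; not-distribˡ-xor;
         ∧-distribˡ-xor; ∧-distribʳ-xor; ∧-zeroʳ; ∧-identityʳ; ∧-assoc; ∧-comm;
         xor-assoc; xor-comm; xor-same; xor-identityʳ; ¬-not)
open import Data.Fin using (Fin; zero; suc; inject₁; fromℕ; _≟_)
open import Data.Fin.Properties using (any?; fromℕ≢inject₁; inject₁-injective)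
open import Data.Fin.Relation.Unary.Top using (view; ‵fromℕ; ‵inject₁)
open import Data.Nat using (ℕ; zero; suc; _+_; _*_)
open import Data.Nat.Divisibility using (divides)
open import Data.Product using (Σ; _×_; _,_; proj₁; proj₂; swap)
open import Data.Sum using (inj₁; inj₂)
open import Data.Vec.Functional using (_∷_; tail)
open import Function using (id; _∘_; _⇔_; mk⇔; Equivalence)
open import Relation.Binary.PropositionalEquality
open import Relation.Nullary using (¬_; yes; no; contradiction)
open import Relation.Nullary.Decidable using (⌊⌋-map′)

open import Algebra.Properties.Semiring.Sum (CommutativeRing.semiring xor-∧-commutativeRing)
open import Algebra.Properties.CommutativeSemigroup (CommutativeMonoid.commutativeSemigroup ∧-commutativeMonoid)
  using (x∙yz≈y∙xz)
open Equivalence using (to; from)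

-- ⌊_⌋ is isYes, which does not reduce through the map′ in Fin's _≟_.
eqV-suc : ∀ {n} (x y : Fin n) → eqV (suc x) (suc y) ≡ eqV x y
eqV-suc x y = ⌊⌋-map′ _ _ (x ≟ y)

eqV-refl : ∀ {n} (x : Fin n) → eqV x x ≡ true
eqV-refl x with x ≟ x
... | yes _   = refl
... | no  x≢x = contradiction refl x≢x

eqV-≢ : ∀ {n} {x y : Fin n} → x ≢ y → eqV x y ≡ false
eqV-≢ {x = x} {y} x≢y with x ≟ y
... | yes x≡y = contradiction x≡y x≢y
... | no  _   = refl

eqV-true⇒≡ : ∀ {n} {x y : Fin n} → eqV x y ≡ true → x ≡ y
eqV-true⇒≡ {x = x} {y} eq with x ≟ y
... | yes x≡y = x≡y

eqV-sym : ∀ {n} (x y : Fin n) → eqV x y ≡ eqV y x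
eqV-sym x y with x ≟ y
... | yes refl = sym (eqV-refl x)
... | no  x≢y  = sym (eqV-≢ (x≢y ∘ sym))

eqV-inject₁ : ∀ {n} (x y : Fin n) → eqV (inject₁ x) (inject₁ y) ≡ eqV x y
eqV-inject₁ x y with x ≟ y
... | yes refl = eqV-refl (inject₁ x)
... | no  x≢y  = eqV-≢ (x≢y ∘ inject₁-injective)

eqV-fromℕ-inject₁ : ∀ {n} (x : Fin n) → eqV (fromℕ n) (inject₁ x) ≡ false
eqV-fromℕ-inject₁ x = eqV-≢ fromℕ≢inject₁

eqV-inject₁-fromℕ : ∀ {n} (x : Fin n) → eqV (inject₁ x) (fromℕ n) ≡ false
eqV-inject₁-fromℕ x = eqV-≢ (fromℕ≢inject₁ ∘ sym)

parity : ℕ → Bool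
parity zero    = false
parity (suc n) = not (parity n)

parity-+ : ∀ m n → parity (m + n) ≡ parity m xor parity n
parity-+ zero    n = refl
parity-+ (suc m) n = trans (cong not (parity-+ m n)) (not-distribˡ-xor (parity m) (parity n))

parity-if : ∀ b n → parity (if b then n else 0) ≡ b ∧ parity n
parity-if true  n = refl
parity-if false n = refl

even⇔parity≡false : ∀ n → Even n ⇔ parity n ≡ false
even⇔parity≡false n = mk⇔ (λ { (divides q refl) → parity-*2 q }) (parity≡false⇒even n)
  where
  parity-*2 : ∀ q → parity (q * 2) ≡ false
  parity-*2 zero    = refl
  parity-*2 (suc q) = cong (not ∘ not) (parity-*2 q)
  parity≡false⇒even : ∀ n → parity n ≡ false → Even n
  parity≡false⇒even zero          _ = divides 0 refl
  parity≡false⇒even (suc (suc n)) p with parity≡false⇒even n (trans (sym (not-involutive (parity n))) p)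
  ... | divides q refl = divides (suc q) refl

parity-indicator : ∀ b → parity (if b then 1 else 0) ≡ b
parity-indicator true  = refl
parity-indicator false = refl

parity-count : ∀ {k} (S : Sub k) → parity (count S) ≡ sum S
parity-count {zero}  S = refl
parity-count {suc k} S = begin
  parity ((if S zero then 1 else 0) + count (tail S))  ≡⟨ parity-+ (if S zero then 1 else 0) _ ⟩
  parity (if S zero then 1 else 0) xor parity (count (tail S))
    ≡⟨ cong₂ _xor_ (parity-indicator (S zero)) (parity-count (tail S)) ⟩
  S zero xor sum (tail S)                              ∎
  where open ≡-Reasoning

even-count⇔ : ∀ {k} (S : Sub k) → Even (count S) ⇔ sum S ≡ false
even-count⇔ S = subst (λ b → Even (count S) ⇔ b ≡ false) (parity-count S) (even⇔parity≡false (count S))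

infix 7 _·_
_·_ : ∀ {m} → Sub m → Sub m → Bool
C · D = sum (C ∩ D)

·-congʳ : ∀ {m} (C : Sub m) {D D′ : Sub m} → D ≗ D′ → C · D ≡ C · D′
·-congʳ C D≗D′ = sum-cong-≗ (λ e → cong (C e ∧_) (D≗D′ e))

·-△ʳ : ∀ {m} (C D E : Sub m) → C · (D △ E) ≡ C · D xor C · E
·-△ʳ C D E = trans (sum-cong-≗ (λ e → ∧-distribˡ-xor (C e) (D e) (E e))) (∑-distrib-+ (C ∩ D) (C ∩ E))

·-△ˡ : ∀ {m} (C D E : Sub m) → (C △ D) · E ≡ C · E xor D · E
·-△ˡ C D E = trans (sum-cong-≗ (λ e → ∧-distribʳ-xor (E e) (C e) (D e))) (∑-distrib-+ (C ∩ E) (D ∩ E))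

infixr 8 _∙_
_∙_ : ∀ {m} → Bool → Sub m → Sub m
(b ∙ D) e = b ∧ D e

·-∙ʳ : ∀ {m} (C : Sub m) b (D : Sub m) → C · (b ∙ D) ≡ b ∧ C · D
·-∙ʳ C b D = trans (sum-cong-≗ (λ e → x∙yz≈y∙xz (C e) b (D e))) (sym (*-distribˡ-sum b (C ∩ D)))

·-comm : ∀ {m} (C D : Sub m) → C · D ≡ D · C
·-comm C D = sum-cong-≗ (λ e → ∧-comm (C e) (D e))

indicator-· : ∀ {n} (k : Fin n) (f : Sub n) → (λ i → eqV i k) · f ≡ f k
indicator-· {suc n} zero    f = trans (cong (f zero xor_) (sum-replicate-zero n)) (xor-identityʳ (f zero))
indicator-· {suc n} (suc k) f =
  trans (sum-cong-≗ (λ i → cong (_∧ f (suc i)) (eqV-suc i k))) (indicator-· k (tail f))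

combination : ∀ {m n} → (Fin n → Sub m) → Sub n → Sub m
combination r U e = sum (λ i → U i ∧ r i e)

InSpan : ∀ {m n} → (Fin n → Sub m) → Sub m → Set
InSpan {n = n} r D = Σ (Sub n) λ U → D ≗ combination r U

·-combination : ∀ {m n} (C : Sub m) (r : Fin n → Sub m) (U : Sub n)
              → C · combination r U ≡ sum (λ i → U i ∧ C · r i)
·-combination C r U = begin
  sum (λ e → C e ∧ sum (λ i → U i ∧ r i e))    ≡⟨ sum-cong-≗ (λ e → *-distribˡ-sum (C e) (λ i → U i ∧ r i e)) ⟩
  sum (λ e → sum (λ i → C e ∧ (U i ∧ r i e)))  ≡⟨ ∑-comm (λ e i → C e ∧ (U i ∧ r i e)) ⟩
  sum (λ i → sum (λ e → C e ∧ (U i ∧ r i e)))  ≡⟨ sum-cong-≗ (λ i → ·-∙ʳ C (U i) (r i)) ⟩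
  sum (λ i → U i ∧ C · r i)                    ∎
  where open ≡-Reasoning

span⊥kernel : ∀ {m n} (r : Fin n → Sub m) {D C : Sub m}
            → InSpan r D → (∀ i → C · r i ≡ false) → C · D ≡ false
span⊥kernel {n = n} r {D} {C} (U , D≗) C⊥r = begin
  C · D                       ≡⟨ ·-congʳ C D≗ ⟩
  C · combination r U         ≡⟨ ·-combination C r U ⟩
  sum (λ i → U i ∧ C · r i)   ≡⟨ sum-cong-≗ (λ i → trans (cong (U i ∧_) (C⊥r i)) (∧-zeroʳ (U i))) ⟩
  sum {n} (λ _ → false)       ≡⟨ sum-replicate-zero n ⟩
  false                       ∎
  where open ≡-Reasoning

inSpan-cong : ∀ {m n} {r : Fin n → Sub m} {D E : Sub m} → D ≗ E → InSpan r E → InSpan r D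
inSpan-cong D≗E (U , E≗) = U , λ e → trans (D≗E e) (E≗ e)

inSpan-generator : ∀ {m n} (r : Fin n → Sub m) k → InSpan r (r k)
inSpan-generator r k = (λ i → eqV i k) , λ e → sym (indicator-· k (λ i → r i e))

inSpan-△ : ∀ {m n} (r : Fin n → Sub m) {D E : Sub m} → InSpan r D → InSpan r E → InSpan r (D △ E)
inSpan-△ r {D} {E} (U , D≗) (V , E≗) = U △ V , λ e → begin
  D e xor E e                                       ≡⟨ cong₂ _xor_ (D≗ e) (E≗ e) ⟩
  combination r U e xor combination r V e           ≡⟨ ∑-distrib-+ (λ i → U i ∧ r i e) (λ i → V i ∧ r i e) ⟨
  sum (λ i → (U i ∧ r i e) xor (V i ∧ r i e))       ≡⟨ sum-cong-≗ (λ i → ∧-distribʳ-xor (r i e) (U i) (V i)) ⟨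
  combination r (U △ V) e                           ∎
  where open ≡-Reasoning

inSpan-∙ : ∀ {m n} (r : Fin n → Sub m) b {D : Sub m} → InSpan r D → InSpan r (b ∙ D)
inSpan-∙ r b {D} (U , D≗) = b ∙ U , λ e → begin
  b ∧ D e                                 ≡⟨ cong (b ∧_) (D≗ e) ⟩
  b ∧ combination r U e                   ≡⟨ *-distribˡ-sum b (λ i → U i ∧ r i e) ⟩
  sum (λ i → b ∧ (U i ∧ r i e))           ≡⟨ sum-cong-≗ (λ i → ∧-assoc b (U i) (r i e)) ⟨
  combination r (b ∙ U) e                 ∎
  where open ≡-Reasoning

inSpan-mono : ∀ {m n p} (r : Fin n → Sub m) (s : Fin p → Sub m)
            → (∀ j → InSpan r (s j)) → ∀ {D} → InSpan s D → InSpan r D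
inSpan-mono {n = n} {p} r s s⊆ {D} (U , D≗) = W , λ e → begin
  D e                                                   ≡⟨ D≗ e ⟩
  sum (λ j → U j ∧ s j e)                               ≡⟨ sum-cong-≗ (λ j → cong (U j ∧_) (proj₂ (s⊆ j) e)) ⟩
  sum (λ j → U j ∧ sum (λ i → V j i ∧ r i e))           ≡⟨ sum-cong-≗ (λ j → *-distribˡ-sum (U j) (λ i → V j i ∧ r i e)) ⟩
  sum (λ j → sum (λ i → U j ∧ (V j i ∧ r i e)))         ≡⟨ ∑-comm (λ j i → U j ∧ (V j i ∧ r i e)) ⟩
  sum (λ i → sum (λ j → U j ∧ (V j i ∧ r i e)))         ≡⟨ sum-cong-≗ (λ i → sum-cong-≗ (λ j → ∧-assoc (U j) (V j i) (r i e))) ⟨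
  sum (λ i → sum (λ j → (U j ∧ V j i) ∧ r i e))         ≡⟨ sum-cong-≗ (λ i → *-distribʳ-sum (r i e) (λ j → U j ∧ V j i)) ⟨
  combination r W e                                     ∎
  where
  open ≡-Reasoning
  V : Fin p → Sub n
  V j = proj₁ (s⊆ j)
  W : Sub n
  W i = sum (λ j → U j ∧ V j i)

inSpan-tail : ∀ {m n} (r : Fin n → Sub (suc m)) {D : Sub (suc m)}
            → (∀ i → r i zero ≡ false) → D zero ≡ false
            → InSpan (tail ∘ r) (tail D) → InSpan r D
inSpan-tail {n = n} r r₀≡false D₀≡false (U , tailD≗) = U , λ
  { zero    → trans D₀≡false (sym (trans (sum-cong-≗ (λ i → trans (cong (U i ∧_) (r₀≡false i)) (∧-zeroʳ (U i))))
                                         (sum-replicate-zero n)))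
  ; (suc e) → tailD≗ e }

unit₀-· : ∀ {m} (x : Sub (suc m)) → (true ∷ λ _ → false) · x ≡ x zero
unit₀-· {m} x = trans (cong (x zero xor_) (sum-replicate-zero m)) (xor-identityʳ (x zero))

eliminate : ∀ {m} → Sub (suc m) → Sub (suc m) → Sub (suc m)
eliminate p x = x △ (x zero ∙ p)

eliminate-zero : ∀ {m} (p : Sub (suc m)) → p zero ≡ true → ∀ x → eliminate p x zero ≡ false
eliminate-zero p p₀≡true x = trans (cong (λ b → x zero xor (x zero ∧ b)) p₀≡true)
                                 (trans (cong (x zero xor_) (∧-identityʳ (x zero))) (xor-same (x zero)))

-- With this first coordinate, a vector orthogonal to the eliminated tails lifts to a vector
-- orthogonal to the original ones.
·-eliminate : ∀ {m} (C : Sub m) (p x : Sub (suc m)) → (C · tail p ∷ C) · x ≡ C · tail (eliminate p x)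
·-eliminate C p x = begin
  (C · tail p ∧ x zero) xor C · tail x     ≡⟨ xor-comm (C · tail p ∧ x zero) (C · tail x) ⟩
  C · tail x xor (C · tail p ∧ x zero)     ≡⟨ cong (C · tail x xor_) (∧-comm (C · tail p) (x zero)) ⟩
  C · tail x xor (x zero ∧ C · tail p)     ≡⟨ cong (C · tail x xor_) (·-∙ʳ C (x zero) (tail p)) ⟨
  C · tail x xor C · (x zero ∙ tail p)     ≡⟨ ·-△ʳ C (tail x) (x zero ∙ tail p) ⟨
  C · tail (eliminate p x)                 ∎
  where open ≡-Reasoning

-- Gaussian elimination on the first coordinate: if some r k has first coordinate 1, it is used as
-- pivot to clear the first coordinate of every r i and of D; then recurse on the tails.
⊥kernel⇒span : ∀ {m n} (r : Fin n → Sub m) (D : Sub m)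
             → (∀ C → (∀ i → C · r i ≡ false) → C · D ≡ false) → InSpan r D
⊥kernel⇒span {zero}          r D _  = (λ _ → false) , λ ()
⊥kernel⇒span {suc m} {n} r D D⊥ with any? (λ i → r i zero Bool.≟ true)
... | no ∄pivot = inSpan-tail r r₀≡false D₀≡false (⊥kernel⇒span (tail ∘ r) (tail D) (λ C → D⊥ (false ∷ C)))
  where
  r₀≡false : ∀ i → r i zero ≡ false
  r₀≡false i = ¬-not (∄pivot ∘ (i ,_))
  D₀≡false : D zero ≡ false
  D₀≡false = trans (sym (unit₀-· D)) (D⊥ (true ∷ λ _ → false) (λ i → trans (unit₀-· (r i)) (r₀≡false i)))
... | yes (k , pivot) =
  inSpan-cong D≗ (inSpan-△ r (inSpan-mono r r′ r′⊆span D′∈span) (inSpan-∙ r (D zero) (inSpan-generator r k)))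
  where
  r′ : Fin n → Sub (suc m)
  r′ = eliminate (r k) ∘ r
  r′⊆span : ∀ j → InSpan r (r′ j)
  r′⊆span j = inSpan-△ r (inSpan-generator r j) (inSpan-∙ r (r j zero) (inSpan-generator r k))
  D′∈span : InSpan r′ (eliminate (r k) D)
  D′∈span = inSpan-tail r′ (eliminate-zero (r k) pivot ∘ r) (eliminate-zero (r k) pivot D)
              (⊥kernel⇒span (tail ∘ r′) (tail (eliminate (r k) D)) λ C C⊥ →
                 trans (sym (·-eliminate C (r k) D))
                       (D⊥ (C · tail (r k) ∷ C) (λ i → trans (·-eliminate C (r k) (r i)) (C⊥ i))))
  D≗ : D ≗ eliminate (r k) D △ (D zero ∙ r k)
  D≗ e = sym (trans (xor-assoc (D e) _ _) (trans (cong (D e xor_) (xor-same (D zero ∧ r k e))) (xor-identityʳ (D e))))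

parity-endsAt : ∀ {m} (H : Graph m) v e → parity (endsAt H v e) ≡ δv H v e
parity-endsAt H v e = begin
  parity (endsAt H v e)                                      ≡⟨ parity-+ (if eqV x v then 1 else 0) _ ⟩
  parity (if eqV x v then 1 else 0) xor parity (if eqV y v then 1 else 0)
    ≡⟨ cong₂ _xor_ (parity-indicator (eqV x v)) (parity-indicator (eqV y v)) ⟩
  eqV x v xor eqV y v                                        ≡⟨ cong₂ _xor_ (eqV-sym x v) (eqV-sym y v) ⟩
  δv H v e                                                   ∎
  where
  open ≡-Reasoning
  x y : Fin (nV H)
  x = proj₁ (ends H e)
  y = proj₂ (ends H e)

parity-deg : ∀ {m} (H : Graph m) C v → parity (deg H C v) ≡ C · δv H v
parity-deg {zero}  H C v = refl
parity-deg {suc m} H C v =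
  trans (parity-+ (if C zero then endsAt H v zero else 0) _)
        (cong₂ _xor_ (trans (parity-if (C zero) _) (cong (C zero ∧_) (parity-endsAt H v zero)))
                     (parity-deg (record { nV = nV H ; ends = ends H ∘ suc }) (tail C) v))

isCycle⇔ : ∀ {m} (H : Graph m) C → IsCycle H C ⇔ (∀ v → C · δv H v ≡ false)
isCycle⇔ H C = mk⇔ (λ cyc v → to (even-deg⇔ v) (cyc v)) (λ C⊥ v → from (even-deg⇔ v) (C⊥ v))
  where
  even-deg⇔ : ∀ v → Even (deg H C v) ⇔ C · δv H v ≡ false
  even-deg⇔ v = subst (λ b → Even (deg H C v) ⇔ b ≡ false) (parity-deg H C v) (even⇔parity≡false (deg H C v))

isCycle-△ : ∀ {m} (H : Graph m) {C D} → IsCycle H C → IsCycle H D → IsCycle H (C △ D)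
isCycle-△ H {C} {D} C-cyc D-cyc = from (isCycle⇔ H (C △ D)) λ v →
  trans (·-△ˡ C D (δv H v)) (cong₂ _xor_ (to (isCycle⇔ H C) C-cyc v) (to (isCycle⇔ H D) D-cyc v))

δ-combination : ∀ {m} (H : Graph m) U → δ H U ≗ combination (δv H) U
δ-combination H U e = sym (begin
  U · (λ u → eqV u x xor eqV u y)           ≡⟨ ·-△ʳ U (λ u → eqV u x) (λ u → eqV u y) ⟩
  U · (λ u → eqV u x) xor U · (λ u → eqV u y) ≡⟨ cong₂ _xor_ (pick x) (pick y) ⟩
  U x xor U y                               ∎)
  where
  open ≡-Reasoning
  x y : Fin (nV H)
  x = proj₁ (ends H e)
  y = proj₂ (ends H e)
  pick : ∀ z → U · (λ u → eqV u z) ≡ U z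
  pick z = trans (·-comm U _) (indicator-· z U)

isCut⇔inSpan : ∀ {m} (H : Graph m) D → IsCut H D ⇔ InSpan (δv H) D
isCut⇔inSpan H D = mk⇔ (λ (U , D≗) → U , λ e → trans (D≗ e) (δ-combination H U e))
                       (λ (U , D≗) → U , λ e → trans (D≗ e) (sym (δ-combination H U e)))

cut⊥cycle : ∀ {m} (H : Graph m) {C D} → IsCycle H C → IsCut H D → C · D ≡ false
cut⊥cycle H {C} {D} C-cyc D-cut = span⊥kernel (δv H) (to (isCut⇔inSpan H D) D-cut) (to (isCycle⇔ H C) C-cyc)

⊥cycles⇒cut : ∀ {m} (H : Graph m) D → (∀ C → IsCycle H C → C · D ≡ false) → IsCut H D
⊥cycles⇒cut H D D⊥ = from (isCut⇔inSpan H D) (⊥kernel⇒span (δv H) D λ C C⊥ → D⊥ C (from (isCycle⇔ H C) C⊥))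

moveEnd-inject₁ : ∀ {n} {u v : Fin n} a x → u ≢ v → eqV (inject₁ u) (moveEnd v a x) ≡ eqV u x
moveEnd-inject₁ {v = v} a x u≢v with x ≟ v
moveEnd-inject₁ {u = u} true  x u≢v | yes refl = eqV-inject₁ u x
moveEnd-inject₁ {u = u} false x u≢v | yes refl = trans (eqV-inject₁-fromℕ u) (sym (eqV-≢ u≢v))
moveEnd-inject₁ {u = u} a     x u≢v | no  _    = eqV-inject₁ u x

moveEnd-v⁻ : ∀ {n} (v : Fin n) a x → eqV (inject₁ v) (moveEnd v a x) ≡ a ∧ eqV v x
moveEnd-v⁻ v a x with x ≟ v
moveEnd-v⁻ v true  x | yes refl = eqV-inject₁ x x
moveEnd-v⁻ v false x | yes refl = eqV-inject₁-fromℕ x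
moveEnd-v⁻ v a     x | no  x≢v  =
  trans (eqV-inject₁ v x) (trans v≠x (sym (trans (cong (a ∧_) v≠x) (∧-zeroʳ a))))
  where
  v≠x : eqV v x ≡ false
  v≠x = eqV-≢ (x≢v ∘ sym)

moveEnd-v⁺ : ∀ {n} (v : Fin n) a x → eqV (fromℕ n) (moveEnd v a x) ≡ not a ∧ eqV v x
moveEnd-v⁺ v a x with x ≟ v
moveEnd-v⁺ v true  x | yes refl = eqV-fromℕ-inject₁ x
moveEnd-v⁺ v false x | yes refl = trans (eqV-refl _) (sym (eqV-refl x))
moveEnd-v⁺ v a     x | no  x≢v  =
  trans (eqV-fromℕ-inject₁ x) (sym (trans (cong (not a ∧_) (eqV-≢ (x≢v ∘ sym))) (∧-zeroʳ (not a))))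

loop⇒δv≡false : ∀ {m} (H : Graph m) w {e} → IsLoop H e → δv H w e ≡ false
loop⇒δv≡false H w {e} loop rewrite eqV-true⇒≡ loop = xor-same (eqV w (proj₂ (ends H e)))

module _ {m} (H : Graph m) (v : Fin (nV H)) (α : Sub m) where

  private
    x y : Fin m → Fin (nV H)
    x e = proj₁ (ends H e)
    y e = proj₂ (ends H e)

  δv-split-inject₁ : ∀ {u} → u ≢ v → δv (split H v α) (inject₁ u) ≗ δv H u
  δv-split-inject₁ {u} u≢v e with isLoopB H e in loop | α e
  ... | true  | true  = trans (cong₂ _xor_ (trans (eqV-inject₁ u v) (eqV-≢ u≢v)) (eqV-inject₁-fromℕ u))
                             (sym (loop⇒δv≡false H u loop))
  ... | true  | false = cong₂ _xor_ (eqV-inject₁ u (x e)) (eqV-inject₁ u (y e))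
  ... | false | a     = cong₂ _xor_ (moveEnd-inject₁ a (x e) u≢v) (moveEnd-inject₁ a (y e) u≢v)

  module _ (adm : Admissible H v α) where

    private
      admissible-δv : ∀ {e} → α e ≡ true → isLoopB H e ≡ false → δv H v e ≡ true
      admissible-δv {e} αe nonloop with adm e αe
      ... | inj₁ e∈δv = e∈δv
      ... | inj₂ loop = contradiction (trans (sym loop) nonloop) λ ()

    δv-split-v⁻ : δv (split H v α) (inject₁ v) ≗ α
    δv-split-v⁻ e with isLoopB H e in loop | α e in αe
    ... | true  | true  = cong₂ _xor_ (eqV-refl (inject₁ v)) (eqV-inject₁-fromℕ v)
    ... | true  | false = trans (cong₂ _xor_ (eqV-inject₁ v (x e)) (eqV-inject₁ v (y e))) (loop⇒δv≡false H v loop)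
    ... | false | true  = trans (cong₂ _xor_ (moveEnd-v⁻ v true (x e)) (moveEnd-v⁻ v true (y e))) (admissible-δv αe loop)
    ... | false | false = cong₂ _xor_ (moveEnd-v⁻ v false (x e)) (moveEnd-v⁻ v false (y e))

    δv-split-v⁺ : δv (split H v α) (fromℕ (nV H)) ≗ α △ δv H v
    δv-split-v⁺ e with isLoopB H e in loop | α e in αe
    ... | true  | true  = trans (cong₂ _xor_ (eqV-fromℕ-inject₁ v) (eqV-refl _)) (cong not (sym (loop⇒δv≡false H v loop)))
    ... | true  | false = trans (cong₂ _xor_ (eqV-fromℕ-inject₁ (x e)) (eqV-fromℕ-inject₁ (y e))) (sym (loop⇒δv≡false H v loop))
    ... | false | true  = trans (cong₂ _xor_ (moveEnd-v⁺ v true (x e)) (moveEnd-v⁺ v true (y e))) (sym (cong not (admissible-δv αe loop)))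
    ... | false | false = cong₂ _xor_ (moveEnd-v⁺ v false (x e)) (moveEnd-v⁺ v false (y e))

    isCycle-split : ∀ C → IsCycle (split H v α) C ⇔ (IsCycle H C × C · α ≡ false)
    isCycle-split C = mk⇔
      (λ cyc → let C⊥ = to (isCycle⇔ (split H v α) C) cyc
                   C⊥α = trans (sym (·-congʳ C δv-split-v⁻)) (C⊥ (inject₁ v))
               in from (isCycle⇔ H C) (⊥δv C⊥ C⊥α) , C⊥α)
      (λ (cyc , C⊥α) → from (isCycle⇔ (split H v α) C) (⊥δv-split (to (isCycle⇔ H C) cyc) C⊥α))
      where
      ⊥δv : (∀ w → C · δv (split H v α) w ≡ false) → C · α ≡ false → ∀ u → C · δv H u ≡ false
      ⊥δv C⊥ C⊥α u with u ≟ v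
      ... | yes refl = begin
        C · δv H v                ≡⟨ cong (_xor C · δv H v) C⊥α ⟨
        C · α xor C · δv H v      ≡⟨ ·-△ʳ C α (δv H v) ⟨
        C · (α △ δv H v)          ≡⟨ ·-congʳ C δv-split-v⁺ ⟨
        C · δv (split H v α) (fromℕ (nV H)) ≡⟨ C⊥ (fromℕ (nV H)) ⟩
        false                     ∎
        where open ≡-Reasoning
      ... | no  u≢v  = trans (sym (·-congʳ C (δv-split-inject₁ u≢v))) (C⊥ (inject₁ u))
      ⊥δv-split : (∀ u → C · δv H u ≡ false) → C · α ≡ false → ∀ w → C · δv (split H v α) w ≡ false
      ⊥δv-split C⊥ C⊥α w with view w
      ... | ‵fromℕ = trans (·-congʳ C δv-split-v⁺) (trans (·-△ʳ C α (δv H v)) (cong₂ _xor_ C⊥α (C⊥ v)))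
      ... | ‵inject₁ u with u ≟ v
      ...   | yes refl = trans (·-congʳ C δv-split-v⁻) C⊥α
      ...   | no  u≢v  = trans (·-congʳ C (δv-split-inject₁ u≢v)) (C⊥ u)

false-iff⇒≡ : ∀ {a b} → (a ≡ false ⇔ b ≡ false) → a ≡ b
false-iff⇒≡ {false} {false} _   = refl
false-iff⇒≡ {false} {true}  a⇔b = sym (to a⇔b refl)
false-iff⇒≡ {true}  {false} a⇔b = from a⇔b refl
false-iff⇒≡ {true}  {true}  _   = refl

module _ {m} {Z : Sub m → Set} (Z-△ : ∀ {C D} → Z C → Z D → Z (C △ D)) where

  -- Adding X when necessary moves C ∈ ker α into ker σ without changing its products with α and β.
  kernel-⊆-by-witness : ∀ {α β σ X} → Z X → X · α ≡ false → X · β ≡ false → X · σ ≡ true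
                      → (∀ {C} → Z C → C · α ≡ false → C · σ ≡ false → C · β ≡ false)
                      → ∀ {C} → Z C → C · α ≡ false → C · β ≡ false
  kernel-⊆-by-witness {α} {β} {σ} {X} ZX X⊥α X⊥β Xσ ⊆β {C} ZC C⊥α with C · σ in Cσ
  ... | false = ⊆β ZC C⊥α Cσ
  ... | true  = begin
    C · β                ≡⟨ trans (cong (C · β xor_) X⊥β) (xor-identityʳ (C · β)) ⟨
    C · β xor X · β      ≡⟨ ·-△ˡ C X β ⟨
    (C △ X) · β          ≡⟨ ⊆β (Z-△ ZC ZX) (trans (·-△ˡ C X α) (cong₂ _xor_ C⊥α X⊥α))
                                          (trans (·-△ˡ C X σ) (cong₂ _xor_ Cσ Xσ)) ⟩
    false                ∎
    where open ≡-Reasoning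

  siblings-kernel : ∀ {α β σ τ}
                  → (∀ {C} → Z C → (C · α ≡ false × C · σ ≡ false) ⇔ (C · β ≡ false × C · τ ≡ false))
                  → ¬ (∀ {C} → Z C → C · α ≡ C · β)
                  → ∀ {X} → Z X → X · α ≡ false → (X · σ ≡ false ⇔ X · β ≡ false)
  siblings-kernel {α} {β} {σ} {τ} same α≉β {X} ZX X⊥α = mk⇔ (λ X⊥σ → proj₁ (to (same ZX) (X⊥α , X⊥σ))) X⊥σ
    where
    X⊥σ : X · β ≡ false → X · σ ≡ false
    X⊥σ X⊥β with X · σ in Xσ
    ... | false = refl
    ... | true  = contradiction (λ {C} ZC → false-iff⇒≡ (mk⇔ (ker-α⊆ker-β ZC) (ker-β⊆ker-α ZC))) α≉β
      where
      Xτ : X · τ ≡ true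
      Xτ = ¬-not λ X⊥τ → contradiction (trans (sym Xσ) (proj₂ (from (same ZX) (X⊥β , X⊥τ)))) λ ()
      ker-α⊆ker-β : ∀ {C} → Z C → C · α ≡ false → C · β ≡ false
      ker-α⊆ker-β = kernel-⊆-by-witness ZX X⊥α X⊥β Xσ λ ZC C⊥α C⊥σ → proj₁ (to (same ZC) (C⊥α , C⊥σ))
      ker-β⊆ker-α : ∀ {C} → Z C → C · β ≡ false → C · α ≡ false
      ker-β⊆ker-α = kernel-⊆-by-witness ZX X⊥β X⊥α Xτ λ ZC C⊥β C⊥τ → proj₁ (from (same ZC) (C⊥β , C⊥τ))

≈G-refl : ∀ {m} {H : Graph m} → H ≈G H
≈G-refl C = id , id

≈G-sym : ∀ {m} {H H′ : Graph m} → H ≈G H′ → H′ ≈G H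
≈G-sym H≈H′ C = swap (H≈H′ C)

≈G-trans : ∀ {m} {H H′ H″ : Graph m} → H ≈G H′ → H′ ≈G H″ → H ≈G H″
≈G-trans H≈H′ H′≈H″ C = proj₁ (H′≈H″ C) ∘ proj₁ (H≈H′ C) , proj₂ (H≈H′ C) ∘ proj₂ (H′≈H″ C)

HasCycles : ∀ {m} → Graph m → (Sub m → Set) → Sub m → Set
HasCycles K Z α = ∀ C → IsCycle K C ⇔ (Z C × C · α ≡ false)

split-hasCycles : ∀ {m} {H H′ : Graph m} {v α} → H ≈G H′ → Admissible H′ v α
                → HasCycles (split H′ v α) (IsCycle H) α
split-hasCycles {H′ = H′} {v} {α} H≈H′ adm C = mk⇔
  (λ cyc → let (H′-cyc , C⊥α) = to (isCycle-split H′ v α adm C) cyc in proj₂ (H≈H′ C) H′-cyc , C⊥α)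
  (λ (H-cyc , C⊥α) → from (isCycle-split H′ v α adm C) (proj₁ (H≈H′ C) H-cyc , C⊥α))

·-cut-invariant : ∀ {m} (H : Graph m) {C α α′} → IsCycle H C → IsCut H (α △ α′) → C · α ≡ C · α′
·-cut-invariant H {C} {α} {α′} C-cyc cut =
  xor-≡false⇒≡ (trans (sym (·-△ʳ C α α′)) (cut⊥cycle H C-cyc cut))
  where
  xor-≡false⇒≡ : ∀ {a b} → a xor b ≡ false → a ≡ b
  xor-≡false⇒≡ {false} {false} _ = refl
  xor-≡false⇒≡ {true}  {true}  _ = refl

hasCycles-cut : ∀ {m} {H K : Graph m} {α α′} → IsCut H (α △ α′)
              → HasCycles K (IsCycle H) α′ → HasCycles K (IsCycle H) α
hasCycles-cut {H = H} cut hasCycles C = mk⇔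
  (λ cyc → let (H-cyc , C⊥α′) = to (hasCycles C) cyc in H-cyc , trans (·-cut-invariant H H-cyc cut) C⊥α′)
  (λ (H-cyc , C⊥α) → from (hasCycles C) (H-cyc , trans (sym (·-cut-invariant H H-cyc cut)) C⊥α))

hasCycles-≈G : ∀ {m} {K K′ : Graph m} {Z α} → HasCycles K Z α → HasCycles K′ Z α → K ≈G K′
hasCycles-≈G K-cycles K′-cycles C = from (K′-cycles C) ∘ to (K-cycles C) , from (K-cycles C) ∘ to (K′-cycles C)

hasCycles-≉G : ∀ {m} {K K′ : Graph m} {Z α β} → HasCycles K Z α → HasCycles K′ Z β
             → ¬ K ≈G K′ → ¬ (∀ {C} → Z C → C · α ≡ C · β)
hasCycles-≉G K-cycles K′-cycles K≉K′ α≈β = K≉K′ λ C →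
    (λ cyc → let (ZC , C⊥α) = to (K-cycles C) cyc in from (K′-cycles C) (ZC , trans (sym (α≈β ZC)) C⊥α))
  , (λ cyc → let (ZC , C⊥β) = to (K′-cycles C) cyc in from (K-cycles C) (ZC , trans (α≈β ZC) C⊥β))

sameECycle⇒kernels : ∀ {m} {K₁ K₂ : Graph m} {Z α β Σ₁ Σ₂} → HasCycles K₁ Z α → HasCycles K₂ Z β
                   → SameECycle K₁ Σ₁ K₂ Σ₂
                   → ∀ {C} → Z C → (C · α ≡ false × C · Σ₁ ≡ false) ⇔ (C · β ≡ false × C · Σ₂ ≡ false)
sameECycle⇒kernels {Σ₁ = Σ₁} {Σ₂} K₁-cycles K₂-cycles same {C} ZC = mk⇔
  (λ (C⊥α , C⊥Σ₁) →
     let (K₂-cyc , even) = proj₁ (same C) (from (K₁-cycles C) (ZC , C⊥α) , from (even-count⇔ (C ∩ Σ₁)) C⊥Σ₁)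
     in proj₂ (to (K₂-cycles C) K₂-cyc) , to (even-count⇔ (C ∩ Σ₂)) even)
  (λ (C⊥β , C⊥Σ₂) →
     let (K₁-cyc , even) = proj₂ (same C) (from (K₂-cycles C) (ZC , C⊥β) , from (even-count⇔ (C ∩ Σ₂)) C⊥Σ₂)
     in proj₂ (to (K₁-cycles C) K₁-cyc) , to (even-count⇔ (C ∩ Σ₁)) even)

siblings-sign : ∀ {m} (H : Graph m) {K₁ K₂ : Graph m} {α β Σ₁ Σ₂}
              → HasCycles K₁ (IsCycle H) α → HasCycles K₂ (IsCycle H) β
              → ¬ (∀ {C} → IsCycle H C → C · α ≡ C · β) → SameECycle K₁ Σ₁ K₂ Σ₂
              → ∀ {C} → IsCycle H C → C · α ≡ false → C · Σ₁ ≡ C · β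
siblings-sign H K₁-cycles K₂-cycles α≉β same H-cyc C⊥α =
  false-iff⇒≡ (siblings-kernel (isCycle-△ H) (sameECycle⇒kernels K₁-cycles K₂-cycles same) α≉β H-cyc C⊥α)

siblings-signedEquiv : ∀ {m} (H : Graph m) {K₁ K₂ K₁′ K₂′ : Graph m} {α β Σ₁ Σ₂ Σ₁′ Σ₂′}
                     → HasCycles K₁ (IsCycle H) α → HasCycles K₂ (IsCycle H) β
                     → HasCycles K₁′ (IsCycle H) α → HasCycles K₂′ (IsCycle H) β
                     → ¬ K₁ ≈G K₂ → SameECycle K₁ Σ₁ K₂ Σ₂ → SameECycle K₁′ Σ₁′ K₂′ Σ₂′
                     → SignedEquiv K₁ Σ₁ K₁′ Σ₁′
siblings-signedEquiv H {K₁} {α = α} {β} {Σ₁} {Σ₁′ = Σ₁′} K₁-cycles K₂-cycles K₁′-cycles K₂′-cycles K₁≉K₂ same same′ =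
  hasCycles-≈G K₁-cycles K₁′-cycles , ⊥cycles⇒cut K₁ (Σ₁ △ Σ₁′) λ C cyc →
    let (H-cyc , C⊥α) = to (K₁-cycles C) cyc
        Σ₁≡Σ₁′ = trans (siblings-sign H K₁-cycles K₂-cycles α≉β same H-cyc C⊥α)
                       (sym (siblings-sign H K₁′-cycles K₂′-cycles α≉β same′ H-cyc C⊥α))
    in trans (·-△ʳ C Σ₁ Σ₁′) (trans (cong (_xor C · Σ₁′) Σ₁≡Σ₁′) (xor-same (C · Σ₁′)))
  where
  α≉β : ¬ (∀ {C} → IsCycle H C → C · α ≡ C · β)
  α≉β = hasCycles-≉G K₁-cycles K₂-cycles K₁≉K₂

lemma7 : ∀ {m} (T T' : SplitTemplate m) → Compatible T T'
       → ∀ (Σ₁ Σ₂ Σ₁' Σ₂' : Sub m)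
       → SplitSiblings T Σ₁ Σ₂ → SplitSiblings T' Σ₁' Σ₂'
       → SignedEquiv (G₁ T) Σ₁ (G₁ T') Σ₁' × SignedEquiv (G₂ T) Σ₂ (G₂ T') Σ₂'
lemma7 T T' (H₁≈H₁' , H₂≈H₂' , α₁-cut , α₂-cut) Σ₁ Σ₂ Σ₁' Σ₂' (same , _) (same' , _) =
    siblings-signedEquiv H G₁-cycles G₂-cycles G₁'-cycles G₂'-cycles (inequivG T) same same'
  , siblings-signedEquiv H G₂-cycles G₁-cycles G₂'-cycles G₁'-cycles (inequivG T ∘ ≈G-sym)
                         (λ C → swap (same C)) (λ C → swap (same' C))
  where
  H : Graph _
  H = H₁ T
  G₁-cycles  : HasCycles (G₁ T) (IsCycle H) (α₁ T)
  G₁-cycles  = split-hasCycles ≈G-refl (adm₁ T)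
  G₂-cycles  : HasCycles (G₂ T) (IsCycle H) (α₂ T)
  G₂-cycles  = split-hasCycles (equivH T) (adm₂ T)
  G₁'-cycles : HasCycles (G₁ T') (IsCycle H) (α₁ T)
  G₁'-cycles = hasCycles-cut α₁-cut (split-hasCycles H₁≈H₁' (adm₁ T'))
  G₂'-cycles : HasCycles (G₂ T') (IsCycle H) (α₂ T)
  G₂'-cycles = hasCycles-cut α₂-cut (split-hasCycles (≈G-trans (equivH T) H₂≈H₂') (adm₂ T'))
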